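{- Let $n\ge 4$ and let $K_n$ be the complete graph on $n$ vertices. A rectilinear drawing of $K_n$ attains the maximal Orchard crossing number ${\rm MOCN}(K_n)$ if and only if it attains the rectilinear crossing number $\overline{\rm cr}(K_n)$, i.e. the drawings of $K_n$ maximizing the Orchard crossing count are exactly the drawings minimizing the number of pairs of crossing edges.
   Context: A finite set of points in $\mathbb{R}^2$ is a generic configuration if no three of its points are collinear. A line $L$ separates two points $P,Q\notin L$ if they lie in different connected components of $\mathbb{R}^2\setminus L$. For a generic configuration $\mathcal P$ and $P,Q\in\mathcal P$, $n(P,Q)$ is the number of lines determined by pairs of points of $\mathcal P\setminus\{P,Q\}$ which separate $P$ and $Q$. A rectilinear drawing $R(G)$ of an abstract graph $G=(V,E)$ is a generic configuration of points in bijection with $V$, each edge drawn as the straight segment between its endpoints. Its (Orchard) crossing number is $n(R(G))=\sum_{(s,t)\in E} n(s,t)$, where $n(s,t)$ is computed in the whole configuration. ${\rm MOCN}(G)=\max_{R(G)} n(R(G))$. The rectilinear crossing number $\overline{\rm cr}(G)$ is the minimum, over rectilinear drawings of $G$, of the number of pairs of edges whose segments cross.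
   Formalization: All rectilinear drawings of $K_n$, both the given one and those competing for ${\rm MOCN}(K_n)$ and $\overline{\rm cr}(K_n)$, have points with rational coordinates rather than points of $\mathbb{R}^2$. -}

module Defs where

open import Data.Nat using (ℕ; _+_; _≤_; _<ᵇ_)
open import Data.Bool using (Bool; true; false; _∧_; not; if_then_else_)
open import Data.Fin using (Fin; toℕ)
open import Data.Fin.Properties using () renaming (_≟_ to _≟ᶠ_)
open import Data.Product using (_×_; _,_; proj₁; proj₂)
open import Data.List using (List; []; _∷_; concatMap; allFin; map)
open import Data.Nat.ListAction using (sum)
open import Data.Rational using (ℚ; 0ℚ; _-_; _*_; _<?_)
open import Relation.Nullary using (¬_)
open import Relation.Nullary.Decidable using (⌊_⌋)
open import Relation.Binary.PropositionalEquality using (_≡_; _≢_)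

Point : Set
Point = ℚ × ℚ

orient : Point → Point → Point → ℚ
orient (px , py) (qx , qy) (rx , ry) = (qx - px) * (ry - py) - (qy - py) * (rx - px)

Placement : ℕ → Set
Placement n = Fin n → Point

-- Generic configuration: no three (distinct-index) points collinear.
-- (This also forces the map to be injective.)
Generic : {n : ℕ} → Placement n → Set
Generic {n} D = (i j k : Fin n) → i ≢ j → j ≢ k → i ≢ k →
  ¬ (orient (D i) (D j) (D k) ≡ 0ℚ)

_≠ᵇ_ : {n : ℕ} → Fin n → Fin n → Bool
i ≠ᵇ j = not ⌊ i ≟ᶠ j ⌋

indicator : Bool → ℕ
indicator true = 1
indicator false = 0

allPairs : (n : ℕ) → List (Fin n × Fin n)
allPairs n = concatMap (λ i → concatMap (λ j →
  if toℕ i <ᵇ toℕ j then (i , j) ∷ [] else []) (allFin n)) (allFin n)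

separatesᵇ : {n : ℕ} → Placement n → Fin n → Fin n → Fin n → Fin n → Bool
separatesᵇ D a b p q =
  ⌊ (orient (D a) (D b) (D p) * orient (D a) (D b) (D q)) <? 0ℚ ⌋

nSep : {n : ℕ} → Placement n → Fin n → Fin n → ℕ
nSep {n} D p q = sum (map (λ ab →
  indicator ((proj₁ ab ≠ᵇ p) ∧ (proj₁ ab ≠ᵇ q) ∧ (proj₂ ab ≠ᵇ p) ∧ (proj₂ ab ≠ᵇ q)
             ∧ separatesᵇ D (proj₁ ab) (proj₂ ab) p q)) (allPairs n))

orchardK : {n : ℕ} → Placement n → ℕ
orchardK {n} D = sum (map (λ st → nSep D (proj₁ st) (proj₂ st)) (allPairs n))

crossᵇ : {n : ℕ} → Placement n → Fin n → Fin n → Fin n → Fin n → Bool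
crossᵇ D i j k l = separatesᵇ D i j k l ∧ separatesᵇ D k l i j

-- Edges sharing an endpoint cannot cross in a generic configuration;
-- each unordered pair {{i,j},{k,l}} of disjoint edges is enumerated once,
-- with i < j, k < l, i < k.
crossingsK : {n : ℕ} → Placement n → ℕ
crossingsK {n} D = sum (concatMap (λ e → map (λ f →
  indicator ((toℕ (proj₁ e) <ᵇ toℕ (proj₁ f))
             ∧ (proj₂ e ≠ᵇ proj₁ f) ∧ (proj₂ e ≠ᵇ proj₂ f)
             ∧ crossᵇ D (proj₁ e) (proj₂ e) (proj₁ f) (proj₂ f)))
  (allPairs n)) (allPairs n))

AttainsMOCN : {n : ℕ} → Placement n → Set
AttainsMOCN {n} D = (D' : Placement n) → Generic D' → orchardK D' ≤ orchardK D

AttainsRectCr : {n : ℕ} → Placement n → Set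
AttainsRectCr {n} D = (D' : Placement n) → Generic D' → crossingsK D ≤ crossingsK D'

-- For four points in general position, consider the three ways of splitting them into two
-- pairs {e , f} and count whether the line through e separates f, whether the line through f
-- separates e, and whether the segments e and f cross.  The total is always 3: in convex
-- position only the pairing into diagonals contributes, with 3, and for a triangle with an
-- interior point each pairing contributes exactly 1.  Every separation counted by the Orchard
-- number and every crossing lives in exactly one such four-point set, so orchardK D + crossingsK D
-- is the same (namely 3 (n choose 4)) for every generic D, and maximising the first term is the
-- same as minimising the second.
--
-- The four-point count is decided by the signs of the orientations of abc, abd, acd and bcd,
-- which satisfy orient abc + orient acd = orient abd + orient bcd; this excludes exactly the
-- two sign patterns for which the count is not 3.  The global count is done over ordered
-- quadruples, where the four-point counts add up to 24 (orchardK D + crossingsK D).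

module Submission where

open import Defs
open import Data.Nat using (ℕ; _≤_)
open import Function.Bundles using (_⇔_; mk⇔; Equivalence)

open import Data.Bool using (Bool; true; false; _∧_; _xor_; not; if_then_else_)
open import Data.Bool.Properties using (∧-comm; ∧-zeroʳ; not-¬; ¬-not; xor-same)
open import Data.Empty using (⊥-elim)
open import Data.Fin using (Fin; toℕ; zero; suc)
open import Data.Fin.Properties using (_≟_; <-cmp)
open import Data.List using (List; []; _∷_; map; concatMap; allFin; tabulate)
open import Data.List.Properties using (map-cong; map-concatMap; map-tabulate)
open import Data.Nat using (_+_; _*_; _<_; _<ᵇ_; zero; suc)
open import Data.Nat.ListAction using (sum)
open import Data.Nat.ListAction.Properties using (sum-++)
open import Data.Nat.Properties as ℕ using (+-identityʳ; +-assoc; *-assoc)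
open import Data.Product using (_×_; _,_; uncurry)
open import Algebra.Properties.CommutativeSemigroup ℕ.+-commutativeSemigroup
  using () renaming (interchange to +-interchange)
open import Algebra.Properties.Semiring.Sum ℕ.+-*-semiring
  using (sum-syntax; ∑-comm; ∑-distrib-+; sum-cong-≗; *-distribˡ-sum)
  renaming (sum to ∑)
import Data.Rational as ℚ
import Data.Rational.Properties as ℚ
open import Data.Rational using (ℚ; 0ℚ)
open import Data.Rational.Solver using (module +-*-Solver)
open +-*-Solver using (Polynomial; solve; _:=_; _:+_; _:-_; _:*_; :-_; con)
open import Relation.Binary.Definitions using (tri<; tri≈; tri>)
open import Relation.Binary.PropositionalEquality
open import Relation.Nullary using (¬_; Dec; yes; no)
open import Relation.Nullary.Decidable using (⌊_⌋; dec-true; dec-false; ¬?; _×-dec_)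

variable
  n : ℕ
  A B : Set

-- Finite sums

sum-concatMap : (h : A → List ℕ) (xs : List A) → sum (concatMap h xs) ≡ sum (map (λ x → sum (h x)) xs)
sum-concatMap h [] = refl
sum-concatMap h (x ∷ xs) = trans (sum-++ (h x) (concatMap h xs)) (cong (sum (h x) +_) (sum-concatMap h xs))

sum-map-concatMap : (g : B → ℕ) (h : A → List B) (xs : List A) →
  sum (map g (concatMap h xs)) ≡ sum (map (λ x → sum (map g (h x))) xs)
sum-map-concatMap g h xs = trans (cong sum (map-concatMap g h xs)) (sum-concatMap (λ x → map g (h x)) xs)

sum-map-+ : (f g : A → ℕ) (xs : List A) →
  sum (map (λ x → f x + g x) xs) ≡ sum (map f xs) + sum (map g xs)
sum-map-+ f g [] = refl
sum-map-+ f g (x ∷ xs) =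
  trans (cong (f x + g x +_) (sum-map-+ f g xs)) (+-interchange (f x) (g x) _ _)

sum-map-zero : (xs : List A) → sum (map (λ _ → 0) xs) ≡ 0
sum-map-zero [] = refl
sum-map-zero (x ∷ xs) = sum-map-zero xs

sum-map-comm : (f : A → B → ℕ) (xs : List A) (ys : List B) →
  sum (map (λ x → sum (map (f x) ys)) xs) ≡ sum (map (λ y → sum (map (λ x → f x y) xs)) ys)
sum-map-comm f [] ys = sym (sum-map-zero ys)
sum-map-comm f (x ∷ xs) ys =
  trans (cong (sum (map (f x) ys) +_) (sum-map-comm f xs ys)) (sym (sum-map-+ (f x) _ ys))

sum-allFin : (f : Fin n → ℕ) → sum (map f (allFin n)) ≡ ∑[ i < n ] f i
sum-allFin f = trans (cong sum (map-tabulate (λ i → i) f)) (sum-tabulate f)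
  where
  sum-tabulate : ∀ {m} (g : Fin m → ℕ) → sum (tabulate g) ≡ ∑[ i < m ] g i
  sum-tabulate {zero} g = refl
  sum-tabulate {suc m} g = cong (g zero +_) (sum-tabulate (λ i → g (suc i)))

<ᵇ-true : ∀ {i j} → i < j → (i <ᵇ j) ≡ true
<ᵇ-true {i} {j} = dec-true (i ℕ.<? j)

<ᵇ-false : ∀ {i j} → ¬ i < j → (i <ᵇ j) ≡ false
<ᵇ-false {i} {j} = dec-false (i ℕ.<? j)

split-by-order : (i j : Fin n) {x y : ℕ} → (i ≡ j → x ≡ 0) → x ≡ y →
  x ≡ (if toℕ i <ᵇ toℕ j then x else 0) + (if toℕ j <ᵇ toℕ i then y else 0)
split-by-order i j diag x≡y with <-cmp i j
... | tri< i<j _ j≮i rewrite <ᵇ-true i<j | <ᵇ-false j≮i = sym (+-identityʳ _)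
... | tri≈ i≮j i≡j j≮i rewrite <ᵇ-false i≮j | <ᵇ-false j≮i = diag i≡j
... | tri> i≮j _ j<i rewrite <ᵇ-false i≮j | <ᵇ-true j<i = x≡y

pairSum : (Fin n → Fin n → ℕ) → ℕ
pairSum {n} f = sum (map (uncurry f) (allPairs n))

pairSum-cong : {f g : Fin n → Fin n → ℕ} → (∀ i j → f i j ≡ g i j) → pairSum f ≡ pairSum g
pairSum-cong {n} f≡g = cong sum (map-cong (λ (i , j) → f≡g i j) (allPairs n))

pairSum-zero : pairSum {n} (λ _ _ → 0) ≡ 0
pairSum-zero {n} = sum-map-zero (allPairs n)

pairSum-distrib-+ : (f g : Fin n → Fin n → ℕ) →
  pairSum (λ i j → f i j + g i j) ≡ pairSum f + pairSum g
pairSum-distrib-+ {n} f g = sum-map-+ (uncurry f) (uncurry g) (allPairs n)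

pairSum-comm : (f : Fin n → Fin n → Fin n → Fin n → ℕ) →
  pairSum (λ i j → pairSum (f i j)) ≡ pairSum (λ k l → pairSum (λ i j → f i j k l))
pairSum-comm {n} f = sum-map-comm (λ (i , j) (k , l) → f i j k l) (allPairs n) (allPairs n)

pairSum-as-∑ : (f : Fin n → Fin n → ℕ) →
  pairSum f ≡ ∑[ i < n ] ∑[ j < n ] (if toℕ i <ᵇ toℕ j then f i j else 0)
pairSum-as-∑ {n} f = begin
  sum (map (uncurry f) (concatMap row (allFin n)))
    ≡⟨ sum-map-concatMap (uncurry f) row (allFin n) ⟩
  sum (map (λ i → sum (map (uncurry f) (row i))) (allFin n))
    ≡⟨ sum-allFin (λ i → sum (map (uncurry f) (row i))) ⟩
  ∑[ i < n ] sum (map (uncurry f) (row i))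
    ≡⟨ sum-cong-≗ sum-row ⟩
  ∑[ i < n ] ∑[ j < n ] (if toℕ i <ᵇ toℕ j then f i j else 0) ∎
  where
  open ≡-Reasoning
  entry : Fin n → Fin n → List (Fin n × Fin n)
  entry i j = if toℕ i <ᵇ toℕ j then (i , j) ∷ [] else []
  row : Fin n → List (Fin n × Fin n)
  row i = concatMap (entry i) (allFin n)
  sum-entry : ∀ i j → sum (map (uncurry f) (entry i j)) ≡ (if toℕ i <ᵇ toℕ j then f i j else 0)
  sum-entry i j with toℕ i <ᵇ toℕ j
  ... | true = +-identityʳ (f i j)
  ... | false = refl
  sum-row : ∀ i → sum (map (uncurry f) (row i)) ≡ ∑[ j < n ] (if toℕ i <ᵇ toℕ j then f i j else 0)
  sum-row i = trans (sum-map-concatMap (uncurry f) (entry i) (allFin n))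
    (trans (cong sum (map-cong (sum-entry i) (allFin n)))
           (sum-allFin (λ j → if toℕ i <ᵇ toℕ j then f i j else 0)))

∑∑-scale : (k : ℕ) (f : Fin n → Fin n → ℕ) →
  ∑[ i < n ] ∑[ j < n ] (k * f i j) ≡ k * ∑[ i < n ] ∑[ j < n ] f i j
∑∑-scale {n} k f =
  trans (sum-cong-≗ (λ i → sym (*-distribˡ-sum k (f i)))) (sym (*-distribˡ-sum k (λ i → ∑[ j < n ] f i j)))

∑∑-symmetric : (f : Fin n → Fin n → ℕ) → (∀ i j → f i j ≡ f j i) → (∀ i → f i i ≡ 0) →
  ∑[ i < n ] ∑[ j < n ] f i j ≡ 2 * pairSum f
∑∑-symmetric {n} f sym-f diag-f = begin
  ∑[ i < n ] ∑[ j < n ] f i j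
    ≡⟨ sum-cong-≗ (λ i → sum-cong-≗ (λ j → split-by-order i j (λ { refl → diag-f i }) (sym-f i j))) ⟩
  ∑[ i < n ] ∑[ j < n ] (L i j + L j i)
    ≡⟨ sum-cong-≗ (λ i → ∑-distrib-+ (L i) (λ j → L j i)) ⟩
  ∑[ i < n ] (∑[ j < n ] L i j + ∑[ j < n ] L j i)
    ≡⟨ ∑-distrib-+ (λ i → ∑[ j < n ] L i j) (λ i → ∑[ j < n ] L j i) ⟩
  ∑L + ∑[ i < n ] ∑[ j < n ] L j i
    ≡⟨ cong (∑L +_) (∑-comm (λ i j → L j i)) ⟩
  ∑L + ∑L
    ≡⟨ cong (∑L +_) (sym (+-identityʳ ∑L)) ⟩
  2 * ∑L
    ≡⟨ cong (2 *_) (sym (pairSum-as-∑ f)) ⟩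
  2 * pairSum f ∎
  where
  open ≡-Reasoning
  L : Fin n → Fin n → ℕ
  L i j = if toℕ i <ᵇ toℕ j then f i j else 0
  ∑L : ℕ
  ∑L = ∑[ i < n ] ∑[ j < n ] L i j

∑⁴ : (Fin n → Fin n → Fin n → Fin n → ℕ) → ℕ
∑⁴ {n} f = ∑[ a < n ] ∑[ b < n ] ∑[ c < n ] ∑[ d < n ] f a b c d

∑⁴-cong : {f g : Fin n → Fin n → Fin n → Fin n → ℕ} →
  (∀ a b c d → f a b c d ≡ g a b c d) → ∑⁴ f ≡ ∑⁴ g
∑⁴-cong f≡g = sum-cong-≗ λ a → sum-cong-≗ λ b → sum-cong-≗ λ c → sum-cong-≗ λ d → f≡g a b c d

∑⁴-distrib-+ : (f g : Fin n → Fin n → Fin n → Fin n → ℕ) →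
  ∑⁴ (λ a b c d → f a b c d + g a b c d) ≡ ∑⁴ f + ∑⁴ g
∑⁴-distrib-+ {n} f g =
  trans (sum-cong-≗ λ a →
    trans (sum-cong-≗ λ b →
      trans (sum-cong-≗ λ c → ∑-distrib-+ (f a b c) (g a b c))
      (∑-distrib-+ (∑₃ f a b) (∑₃ g a b)))
    (∑-distrib-+ (∑₂ f a) (∑₂ g a)))
  (∑-distrib-+ (∑₁ f) (∑₁ g))
  where
  ∑₃ : (Fin n → Fin n → Fin n → Fin n → ℕ) → Fin n → Fin n → Fin n → ℕ
  ∑₃ h a b c = ∑[ d < n ] h a b c d
  ∑₂ : (Fin n → Fin n → Fin n → Fin n → ℕ) → Fin n → Fin n → ℕ
  ∑₂ h a b = ∑[ c < n ] ∑₃ h a b c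
  ∑₁ : (Fin n → Fin n → Fin n → Fin n → ℕ) → Fin n → ℕ
  ∑₁ h a = ∑[ b < n ] ∑₂ h a b

∑⁴-swap₁₂ : (f : Fin n → Fin n → Fin n → Fin n → ℕ) → ∑⁴ f ≡ ∑⁴ (λ a b c d → f b a c d)
∑⁴-swap₁₂ {n} f = ∑-comm (λ a b → ∑[ c < n ] ∑[ d < n ] f a b c d)

∑⁴-swap₂₃ : (f : Fin n → Fin n → Fin n → Fin n → ℕ) → ∑⁴ f ≡ ∑⁴ (λ a b c d → f a c b d)
∑⁴-swap₂₃ {n} f = sum-cong-≗ λ a → ∑-comm (λ b c → ∑[ d < n ] f a b c d)

∑⁴-swap₃₄ : (f : Fin n → Fin n → Fin n → Fin n → ℕ) → ∑⁴ f ≡ ∑⁴ (λ a b c d → f a b d c)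
∑⁴-swap₃₄ f = sum-cong-≗ λ a → sum-cong-≗ λ b → ∑-comm (f a b)

∑⁴-swapPairs : (f : Fin n → Fin n → Fin n → Fin n → ℕ) → ∑⁴ f ≡ ∑⁴ (λ a b c d → f c d a b)
∑⁴-swapPairs f = begin
  ∑⁴ f                            ≡⟨ ∑⁴-swap₂₃ f ⟩
  ∑⁴ (λ a b c d → f a c b d)      ≡⟨ ∑⁴-swap₁₂ (λ a b c d → f a c b d) ⟩
  ∑⁴ (λ a b c d → f b c a d)      ≡⟨ ∑⁴-swap₃₄ (λ a b c d → f b c a d) ⟩
  ∑⁴ (λ a b c d → f b d a c)      ≡⟨ ∑⁴-swap₂₃ (λ a b c d → f b d a c) ⟩
  ∑⁴ (λ a b c d → f c d a b)      ∎
  where open ≡-Reasoning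

∑⁴-symmetric : (f : Fin n → Fin n → Fin n → Fin n → ℕ) →
  (∀ a b c d → f a b c d ≡ f b a c d) → (∀ a b c d → f a b c d ≡ f a b d c) →
  (∀ a c d → f a a c d ≡ 0) → (∀ a b c → f a b c c ≡ 0) →
  ∑⁴ f ≡ 4 * pairSum (λ a b → pairSum (f a b))
∑⁴-symmetric {n} f sym₁₂ sym₃₄ diag₁₂ diag₃₄ = begin
  ∑⁴ f
    ≡⟨ sum-cong-≗ (λ a → sum-cong-≗ (λ b → ∑∑-symmetric (f a b) (sym₃₄ a b) (diag₃₄ a b))) ⟩
  ∑[ a < n ] ∑[ b < n ] (2 * pairSum (f a b))
    ≡⟨ ∑∑-scale 2 (λ a b → pairSum (f a b)) ⟩
  2 * ∑[ a < n ] ∑[ b < n ] pairSum (f a b)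
    ≡⟨ cong (2 *_) (∑∑-symmetric (λ a b → pairSum (f a b))
         (λ a b → pairSum-cong (sym₁₂ a b)) (λ a → trans (pairSum-cong (diag₁₂ a)) (pairSum-zero {n}))) ⟩
  2 * (2 * pairSum (λ a b → pairSum (f a b)))
    ≡⟨ sym (*-assoc 2 2 (pairSum (λ a b → pairSum (f a b)))) ⟩
  4 * pairSum (λ a b → pairSum (f a b)) ∎
  where open ≡-Reasoning

-- Signs of rationals

isNeg : ℚ → Bool
isNeg x = ⌊ x ℚ.<? 0ℚ ⌋

isNeg-true : ∀ {x} → x ℚ.< 0ℚ → isNeg x ≡ true
isNeg-true {x} x<0 with x ℚ.<? 0ℚ
... | yes _ = refl
... | no x≮0 = ⊥-elim (x≮0 x<0)

isNeg-false : ∀ {x} → 0ℚ ℚ.< x → isNeg x ≡ false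
isNeg-false {x} 0<x with x ℚ.<? 0ℚ
... | yes x<0 = ⊥-elim (ℚ.<-asym 0<x x<0)
... | no _ = refl

isNeg⇒<0 : ∀ {x} → isNeg x ≡ true → x ℚ.< 0ℚ
isNeg⇒<0 {x} neg with x ℚ.<? 0ℚ
isNeg⇒<0 {x} neg | yes x<0 = x<0
isNeg⇒<0 {x} () | no _

¬isNeg⇒>0 : ∀ {x} → x ≢ 0ℚ → isNeg x ≡ false → 0ℚ ℚ.< x
¬isNeg⇒>0 {x} x≢0 nonneg with ℚ.<-cmp x 0ℚ
... | tri< x<0 _ _ = ⊥-elim (not-¬ (isNeg-true x<0) nonneg)
... | tri≈ _ x≡0 _ = ⊥-elim (x≢0 x≡0)
... | tri> _ _ 0<x = 0<x

isNeg-* : ∀ {x y} → x ≢ 0ℚ → y ≢ 0ℚ → isNeg (x ℚ.* y) ≡ isNeg x xor isNeg y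
isNeg-* {x} {y} x≢0 y≢0 with ℚ.<-cmp x 0ℚ | ℚ.<-cmp y 0ℚ
... | tri≈ _ x≡0 _ | _ = ⊥-elim (x≢0 x≡0)
... | _ | tri≈ _ y≡0 _ = ⊥-elim (y≢0 y≡0)
... | tri< x<0 _ _ | tri< y<0 _ _ rewrite isNeg-true x<0 | isNeg-true y<0 =
  isNeg-false (ℚ.positive⁻¹ (x ℚ.* y) {{ℚ.neg*neg⇒pos x {{ℚ.negative x<0}} y {{ℚ.negative y<0}}}})
... | tri< x<0 _ _ | tri> _ _ 0<y rewrite isNeg-true x<0 | isNeg-false 0<y =
  isNeg-true (ℚ.negative⁻¹ (x ℚ.* y) {{ℚ.neg*pos⇒neg x {{ℚ.negative x<0}} y {{ℚ.positive 0<y}}}})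
... | tri> _ _ 0<x | tri< y<0 _ _ rewrite isNeg-false 0<x | isNeg-true y<0 =
  isNeg-true (ℚ.negative⁻¹ (x ℚ.* y) {{ℚ.pos*neg⇒neg x {{ℚ.positive 0<x}} y {{ℚ.negative y<0}}}})
... | tri> _ _ 0<x | tri> _ _ 0<y rewrite isNeg-false 0<x | isNeg-false 0<y =
  isNeg-false (ℚ.positive⁻¹ (x ℚ.* y) {{ℚ.pos*pos⇒pos x {{ℚ.positive 0<x}} y {{ℚ.positive 0<y}}}})

isNeg-neg : ∀ {x} → x ≢ 0ℚ → isNeg (ℚ.- x) ≡ not (isNeg x)
isNeg-neg {x} x≢0 with ℚ.<-cmp x 0ℚ
... | tri< x<0 _ _ rewrite isNeg-true x<0 = isNeg-false (ℚ.neg-antimono-< x<0)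
... | tri≈ _ x≡0 _ = ⊥-elim (x≢0 x≡0)
... | tri> _ _ 0<x rewrite isNeg-false 0<x = isNeg-true (ℚ.neg-antimono-< 0<x)

isNeg-square : ∀ x → isNeg (x ℚ.* x) ≡ false
isNeg-square x with x ℚ.≟ 0ℚ
... | yes refl = refl
... | no x≢0 = trans (isNeg-* x≢0 x≢0) (xor-same (isNeg x))

isNeg-*⇒≢0 : ∀ {x y} → isNeg (x ℚ.* y) ≡ true → x ≢ 0ℚ × y ≢ 0ℚ
isNeg-*⇒≢0 {x} {y} neg = x≢0 , y≢0
  where
  x≢0 : x ≢ 0ℚ
  x≢0 refl = not-¬ (cong isNeg (ℚ.*-zeroˡ y)) neg
  y≢0 : y ≢ 0ℚ
  y≢0 refl = not-¬ (cong isNeg (ℚ.*-zeroʳ x)) neg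

neg+neg≢pos+pos : ∀ {a b c d} → a ℚ.< 0ℚ → b ℚ.< 0ℚ → 0ℚ ℚ.< c → 0ℚ ℚ.< d →
  a ℚ.+ b ≢ c ℚ.+ d
neg+neg≢pos+pos a<0 b<0 0<c 0<d a+b≡c+d =
  ℚ.<-irrefl a+b≡c+d (ℚ.<-trans (ℚ.+-mono-< a<0 b<0) (ℚ.+-mono-< 0<c 0<d))

isNeg-balanced : ∀ {x₁ x₂ x₃ x₄} → x₁ ℚ.+ x₃ ≡ x₂ ℚ.+ x₄ →
  x₁ ≢ 0ℚ → x₂ ≢ 0ℚ → x₃ ≢ 0ℚ → x₄ ≢ 0ℚ →
  isNeg x₁ ≡ isNeg x₃ → isNeg x₂ ≡ isNeg x₄ → isNeg x₁ ≡ isNeg x₂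
isNeg-balanced {x₁} {x₂} balanced nz₁ nz₂ nz₃ nz₄ s₁₃ s₂₄ with isNeg x₁ in s₁ | isNeg x₂ in s₂
... | true | true = refl
... | false | false = refl
... | true | false = ⊥-elim (neg+neg≢pos+pos (isNeg⇒<0 s₁) (isNeg⇒<0 (sym s₁₃))
                              (¬isNeg⇒>0 nz₂ s₂) (¬isNeg⇒>0 nz₄ (sym s₂₄)) balanced)
... | false | true = ⊥-elim (neg+neg≢pos+pos (isNeg⇒<0 s₂) (isNeg⇒<0 (sym s₂₄))
                              (¬isNeg⇒>0 nz₁ s₁) (¬isNeg⇒>0 nz₃ (sym s₁₃)) (sym balanced))

-- Orientation

orientᴾ : ∀ {m} → (px py qx qy rx ry : Polynomial m) → Polynomial m
orientᴾ px py qx qy rx ry = (qx :- px) :* (ry :- py) :- (qy :- py) :* (rx :- px)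

orient-rotate : ∀ P Q R → orient P Q R ≡ orient Q R P
orient-rotate (px , py) (qx , qy) (rx , ry) =
  solve 6 (λ px py qx qy rx ry → orientᴾ px py qx qy rx ry := orientᴾ qx qy rx ry px py)
    refl px py qx qy rx ry

orient-swap : ∀ P Q R → orient P R Q ≡ ℚ.- orient P Q R
orient-swap (px , py) (qx , qy) (rx , ry) =
  solve 6 (λ px py qx qy rx ry → orientᴾ px py rx ry qx qy := :- orientᴾ px py qx qy rx ry)
    refl px py qx qy rx ry

orient-four : ∀ P Q R S → orient P Q R ℚ.+ orient P R S ≡ orient P Q S ℚ.+ orient Q R S
orient-four (px , py) (qx , qy) (rx , ry) (sx , sy) =
  solve 8 (λ px py qx qy rx ry sx sy →
      orientᴾ px py qx qy rx ry :+ orientᴾ px py rx ry sx sy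
   := orientᴾ px py qx qy sx sy :+ orientᴾ qx qy rx ry sx sy)
    refl px py qx qy rx ry sx sy

orient-swapLine-* : ∀ P Q R S → orient Q P R ℚ.* orient Q P S ≡ orient P Q R ℚ.* orient P Q S
orient-swapLine-* (px , py) (qx , qy) (rx , ry) (sx , sy) =
  solve 8 (λ px py qx qy rx ry sx sy →
      orientᴾ qx qy px py rx ry :* orientᴾ qx qy px py sx sy
   := orientᴾ px py qx qy rx ry :* orientᴾ px py qx qy sx sy)
    refl px py qx qy rx ry sx sy

orient-diag₁₂ : ∀ P R → orient P P R ≡ 0ℚ
orient-diag₁₂ (px , py) (rx , ry) =
  solve 4 (λ px py rx ry → orientᴾ px py px py rx ry := con 0ℚ) refl px py rx ry

orient-diag₂₃ : ∀ P Q → orient P Q Q ≡ 0ℚ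
orient-diag₂₃ P Q = trans (orient-rotate P Q Q) (orient-diag₁₂ Q P)

orient-diag₁₃ : ∀ P Q → orient P Q P ≡ 0ℚ
orient-diag₁₃ P Q = trans (orient-rotate P Q P) (orient-diag₂₃ Q P)

-- Separation by lines

Distinct4 : (a b c d : Fin n) → Set
Distinct4 a b c d = a ≢ b × a ≢ c × a ≢ d × b ≢ c × b ≢ d × c ≢ d

distinct4? : (a b c d : Fin n) → Dec (Distinct4 a b c d)
distinct4? a b c d =
  ¬? (a ≟ b) ×-dec ¬? (a ≟ c) ×-dec ¬? (a ≟ d) ×-dec ¬? (b ≟ c) ×-dec ¬? (b ≟ d) ×-dec ¬? (c ≟ d)

module _ {a b c d : Fin n} where

  distinct4-swap₂₃ : Distinct4 a b c d → Distinct4 a c b d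
  distinct4-swap₂₃ (ab , ac , ad , bc , bd , cd) = ac , ab , ad , ≢-sym bc , cd , bd

  distinct4-swap₃₄ : Distinct4 a b c d → Distinct4 a b d c
  distinct4-swap₃₄ (ab , ac , ad , bc , bd , cd) = ab , ad , ac , bd , bc , ≢-sym cd

  distinct4-swapPairs : Distinct4 a b c d → Distinct4 c d a b
  distinct4-swapPairs (ab , ac , ad , bc , bd , cd) = cd , ≢-sym ac , ≢-sym bc , ≢-sym ad , ≢-sym bd , ab

  ¬distinct4₁₂ : a ≡ b → ¬ Distinct4 a b c d
  ¬distinct4₁₂ refl (a≢a , _) = a≢a refl

  ¬distinct4₁₃ : a ≡ c → ¬ Distinct4 a b c d
  ¬distinct4₁₃ refl (_ , a≢a , _) = a≢a refl

  ¬distinct4₃₄ : c ≡ d → ¬ Distinct4 a b c d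
  ¬distinct4₃₄ refl (_ , _ , _ , _ , _ , c≢c) = c≢c refl

clockwise : Placement n → Fin n → Fin n → Fin n → Bool
clockwise D a b c = isNeg (orient (D a) (D b) (D c))

module _ (D : Placement n) where

  orient-nonzero⇒distinct : ∀ {a b c} → orient (D a) (D b) (D c) ≢ 0ℚ → a ≢ b × a ≢ c × b ≢ c
  orient-nonzero⇒distinct {a} {b} {c} nz = a≢b , a≢c , b≢c
    where
    a≢b : a ≢ b
    a≢b refl = nz (orient-diag₁₂ (D a) (D c))
    a≢c : a ≢ c
    a≢c refl = nz (orient-diag₁₃ (D a) (D b))
    b≢c : b ≢ c
    b≢c refl = nz (orient-diag₂₃ (D a) (D b))

  separates⇒distinct : ∀ {a b p q} → separatesᵇ D a b p q ≡ true → Distinct4 a b p q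
  separates⇒distinct {a} {b} {p} {q} sep with isNeg-*⇒≢0 sep
  ... | nz-p , nz-q with orient-nonzero⇒distinct nz-p | orient-nonzero⇒distinct nz-q
  ... | a≢b , a≢p , b≢p | _ , a≢q , b≢q = a≢b , a≢p , a≢q , b≢p , b≢q , p≢q
    where
    p≢q : p ≢ q
    p≢q refl = not-¬ (isNeg-square (orient (D a) (D b) (D p))) sep

  separates-nondistinct : ∀ {a b p q} → ¬ Distinct4 a b p q → separatesᵇ D a b p q ≡ false
  separates-nondistinct ¬δ = ¬-not (λ sep → ¬δ (separates⇒distinct sep))

  separates-swapLine : ∀ a b p q → separatesᵇ D a b p q ≡ separatesᵇ D b a p q
  separates-swapLine a b p q = sym (cong isNeg (orient-swapLine-* (D a) (D b) (D p) (D q)))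

  separates-swapPoints : ∀ a b p q → separatesᵇ D a b p q ≡ separatesᵇ D a b q p
  separates-swapPoints a b p q = cong isNeg (ℚ.*-comm (orient (D a) (D b) (D p)) (orient (D a) (D b) (D q)))

  clockwise-rotate : ∀ a b c → clockwise D a b c ≡ clockwise D b c a
  clockwise-rotate a b c = cong isNeg (orient-rotate (D a) (D b) (D c))

  clockwise-swap : ∀ {a b c} → orient (D a) (D b) (D c) ≢ 0ℚ → clockwise D a c b ≡ not (clockwise D a b c)
  clockwise-swap {a} {b} {c} nz = trans (cong isNeg (orient-swap (D a) (D b) (D c))) (isNeg-neg nz)

  module _ (generic : Generic D) where

    separates-clockwise : ∀ {a b p q} → Distinct4 a b p q →
      separatesᵇ D a b p q ≡ clockwise D a b p xor clockwise D a b q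
    separates-clockwise {a} {b} {p} {q} (ab , ap , aq , bp , bq , _) =
      isNeg-* (generic a b p ab bp ap) (generic a b q ab bq aq)

    clockwise-balanced : ∀ {a b c d} → Distinct4 a b c d →
      clockwise D a b c ≡ clockwise D a c d → clockwise D a b d ≡ clockwise D b c d →
      clockwise D a b c ≡ clockwise D a b d
    clockwise-balanced {a} {b} {c} {d} (ab , ac , ad , bc , bd , cd) =
      isNeg-balanced (orient-four (D a) (D b) (D c) (D d))
        (generic a b c ab bc ac) (generic a b d ab bd ad) (generic a c d ac cd ad) (generic b c d bc cd bd)

-- Four points

pairCount : Bool → Bool → ℕ
pairCount u v = indicator u + indicator v + indicator (u ∧ v)

pairingCount : Placement n → Fin n → Fin n → Fin n → Fin n → ℕ
pairingCount D a b c d = pairCount (separatesᵇ D a b c d) (separatesᵇ D c d a b)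

fourPointCount : Placement n → Fin n → Fin n → Fin n → Fin n → ℕ
fourPointCount D a b c d = pairingCount D a b c d + pairingCount D a c b d + pairingCount D a d b c

pairCounts-of-signs : ∀ s₁ s₂ s₃ s₄ → (s₁ ≡ s₃ → s₂ ≡ s₄ → s₁ ≡ s₂) →
  pairCount (s₁ xor s₂) (s₃ xor s₄) + pairCount (not s₁ xor s₃) (s₂ xor not s₄)
    + pairCount (not s₂ xor not s₃) (s₁ xor s₄) ≡ 3
pairCounts-of-signs false false false false _ = refl
pairCounts-of-signs false false false true  _ = refl
pairCounts-of-signs false false true  false _ = refl
pairCounts-of-signs false false true  true  _ = refl
pairCounts-of-signs false true  false false _ = refl
pairCounts-of-signs false true  false true  balanced with () ← balanced refl refl
pairCounts-of-signs false true  true  false _ = refl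
pairCounts-of-signs false true  true  true  _ = refl
pairCounts-of-signs true  false false false _ = refl
pairCounts-of-signs true  false false true  _ = refl
pairCounts-of-signs true  false true  false balanced with () ← balanced refl refl
pairCounts-of-signs true  false true  true  _ = refl
pairCounts-of-signs true  true  false false _ = refl
pairCounts-of-signs true  true  false true  _ = refl
pairCounts-of-signs true  true  true  false _ = refl
pairCounts-of-signs true  true  true  true  _ = refl

module _ (D : Placement n) where

  fourPointCount-distinct : ∀ {a b c d} → Generic D → Distinct4 a b c d → fourPointCount D a b c d ≡ 3
  fourPointCount-distinct {a} {b} {c} {d} generic δ@(ab , ac , ad , bc , bd , cd) =
    trans (cong₂ _+_ (cong₂ _+_ (cong₂ pairCount e₁ e₂) (cong₂ pairCount e₃ e₄))
                     (cong₂ pairCount e₅ e₆))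
      (pairCounts-of-signs s₁ s₂ s₃ s₄ (clockwise-balanced D generic δ))
    where
    s₁ s₂ s₃ s₄ : Bool
    s₁ = clockwise D a b c
    s₂ = clockwise D a b d
    s₃ = clockwise D a c d
    s₄ = clockwise D b c d
    δ-adbc : Distinct4 a d b c
    δ-adbc = distinct4-swap₂₃ (distinct4-swap₃₄ δ)
    e₁ : separatesᵇ D a b c d ≡ s₁ xor s₂
    e₁ = separates-clockwise D generic δ
    e₂ : separatesᵇ D c d a b ≡ s₃ xor s₄
    e₂ = trans (separates-clockwise D generic (distinct4-swapPairs δ))
      (cong₂ _xor_ (sym (clockwise-rotate D a c d)) (sym (clockwise-rotate D b c d)))
    e₃ : separatesᵇ D a c b d ≡ not s₁ xor s₃
    e₃ = trans (separates-clockwise D generic (distinct4-swap₂₃ δ))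
      (cong (_xor s₃) (clockwise-swap D (generic a b c ab bc ac)))
    e₄ : separatesᵇ D b d a c ≡ s₂ xor not s₄
    e₄ = trans (separates-clockwise D generic (distinct4-swapPairs (distinct4-swap₂₃ δ)))
      (cong₂ _xor_ (sym (clockwise-rotate D a b d)) (clockwise-swap D (generic b c d bc cd bd)))
    e₅ : separatesᵇ D a d b c ≡ not s₂ xor not s₃
    e₅ = trans (separates-clockwise D generic δ-adbc)
      (cong₂ _xor_ (clockwise-swap D (generic a b d ab bd ad)) (clockwise-swap D (generic a c d ac cd ad)))
    e₆ : separatesᵇ D b c a d ≡ s₁ xor s₄
    e₆ = trans (separates-clockwise D generic (distinct4-swapPairs δ-adbc))
      (cong (_xor s₄) (sym (clockwise-rotate D a b c)))

  pairingCount-nondistinct : ∀ {a b c d} → ¬ Distinct4 a b c d → pairingCount D a b c d ≡ 0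
  pairingCount-nondistinct ¬δ
    rewrite separates-nondistinct D ¬δ | separates-nondistinct D (λ δ → ¬δ (distinct4-swapPairs δ)) = refl

  fourPointCount-nondistinct : ∀ {a b c d} → ¬ Distinct4 a b c d → fourPointCount D a b c d ≡ 0
  fourPointCount-nondistinct ¬δ =
    cong₂ _+_ (cong₂ _+_ (pairingCount-nondistinct ¬δ)
                         (pairingCount-nondistinct (λ δ → ¬δ (distinct4-swap₂₃ δ))))
              (pairingCount-nondistinct (λ δ → ¬δ (distinct4-swap₃₄ (distinct4-swap₂₃ δ))))

  fourPointCount-generic : Generic D →
    ∀ a b c d → fourPointCount D a b c d ≡ 3 * indicator ⌊ distinct4? a b c d ⌋
  fourPointCount-generic generic a b c d with distinct4? a b c d
  ... | yes δ = fourPointCount-distinct generic δ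
  ... | no ¬δ = fourPointCount-nondistinct ¬δ

-- Counting over ordered quadruples

≢⇒≠ᵇ : {i j : Fin n} → i ≢ j → (i ≠ᵇ j) ≡ true
≢⇒≠ᵇ {i = i} {j} i≢j with i ≟ j
... | yes i≡j = ⊥-elim (i≢j i≡j)
... | no _ = refl

module _ (D : Placement n) where

  separates-guarded : ∀ a b p q →
    (a ≠ᵇ p) ∧ (a ≠ᵇ q) ∧ (b ≠ᵇ p) ∧ (b ≠ᵇ q) ∧ separatesᵇ D a b p q ≡ separatesᵇ D a b p q
  separates-guarded a b p q with separatesᵇ D a b p q in sep
  ... | false
    rewrite ∧-zeroʳ (b ≠ᵇ q) | ∧-zeroʳ (b ≠ᵇ p) | ∧-zeroʳ (a ≠ᵇ q) | ∧-zeroʳ (a ≠ᵇ p) = refl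
  ... | true with separates⇒distinct D sep
  ... | _ , a≢p , a≢q , b≢p , b≢q , _
    rewrite ≢⇒≠ᵇ a≢p | ≢⇒≠ᵇ a≢q | ≢⇒≠ᵇ b≢p | ≢⇒≠ᵇ b≢q = refl

  crosses-guarded : ∀ i j k l →
    indicator ((toℕ i <ᵇ toℕ k) ∧ (j ≠ᵇ k) ∧ (j ≠ᵇ l) ∧ separatesᵇ D i j k l ∧ separatesᵇ D k l i j)
      ≡ (if toℕ i <ᵇ toℕ k then indicator (separatesᵇ D i j k l ∧ separatesᵇ D k l i j) else 0)
  crosses-guarded i j k l with toℕ i <ᵇ toℕ k
  ... | false = refl
  ... | true with separatesᵇ D i j k l in sep
  ...   | false rewrite ∧-zeroʳ (j ≠ᵇ l) | ∧-zeroʳ (j ≠ᵇ k) = refl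
  ...   | true with separates⇒distinct D sep
  ...     | _ , _ , _ , j≢k , j≢l , _ rewrite ≢⇒≠ᵇ j≢k | ≢⇒≠ᵇ j≢l = refl

  ∑⁴-separates : ∑⁴ (λ p q a b → indicator (separatesᵇ D a b p q)) ≡ 4 * orchardK D
  ∑⁴-separates =
    trans (∑⁴-symmetric S
            (λ p q a b → cong indicator (separates-swapPoints D a b p q))
            (λ p q a b → cong indicator (separates-swapLine D a b p q))
            (λ p a b → cong indicator (separates-nondistinct D (¬distinct4₃₄ refl)))
            (λ p q a → cong indicator (separates-nondistinct D (¬distinct4₁₂ refl))))
      (cong (4 *_) (pairSum-cong λ p q → pairSum-cong λ a b →
         cong indicator (sym (separates-guarded a b p q))))
    where
    S : Fin n → Fin n → Fin n → Fin n → ℕ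
    S p q a b = indicator (separatesᵇ D a b p q)

  ∑⁴-crosses : ∑⁴ (λ i j k l → indicator (crossᵇ D i j k l)) ≡ 8 * crossingsK D
  ∑⁴-crosses = begin
    ∑⁴ X
      ≡⟨ ∑⁴-symmetric X sym₁₂ sym₃₄ (λ i k l → X-nondistinct (¬distinct4₁₂ refl))
                                    (λ i j k → X-nondistinct (¬distinct4₃₄ refl)) ⟩
    4 * pairSum (λ i j → pairSum (X i j))
      ≡⟨ cong (4 *_) (pairSum-cong λ i j → pairSum-cong λ k l →
           split-by-order i k (λ i≡k → X-nondistinct (¬distinct4₁₃ i≡k)) (X-swapPairs i j k l)) ⟩
    4 * pairSum (λ i j → pairSum (λ k l → L i j k l + L k l i j))
      ≡⟨ cong (4 *_) (trans (pairSum-cong λ i j → pairSum-distrib-+ (L i j) (λ k l → L k l i j))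
                            (pairSum-distrib-+ (λ i j → pairSum (L i j))
                                               (λ i j → pairSum (λ k l → L k l i j)))) ⟩
    4 * (P + pairSum (λ i j → pairSum (λ k l → L k l i j)))
      ≡⟨ cong (λ t → 4 * (P + t)) (pairSum-comm (λ i j k l → L k l i j)) ⟩
    4 * (P + P)
      ≡⟨ cong (λ t → 4 * (t + t)) (sym crossingsK≡P) ⟩
    4 * (crossingsK D + crossingsK D)
      ≡⟨ trans (ℕ.*-distribˡ-+ 4 (crossingsK D) (crossingsK D))
               (sym (ℕ.*-distribʳ-+ (crossingsK D) 4 4)) ⟩
    8 * crossingsK D ∎
    where
    open ≡-Reasoning
    X L : Fin n → Fin n → Fin n → Fin n → ℕ
    X i j k l = indicator (crossᵇ D i j k l)
    L i j k l = if toℕ i <ᵇ toℕ k then X i j k l else 0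
    P : ℕ
    P = pairSum (λ i j → pairSum (L i j))
    X-nondistinct : ∀ {i j k l} → ¬ Distinct4 i j k l → X i j k l ≡ 0
    X-nondistinct {i} {j} {k} {l} ¬δ =
      cong (λ s → indicator (s ∧ separatesᵇ D k l i j)) (separates-nondistinct D ¬δ)
    sym₁₂ : ∀ i j k l → X i j k l ≡ X j i k l
    sym₁₂ i j k l = cong indicator (cong₂ _∧_ (separates-swapLine D i j k l) (separates-swapPoints D k l i j))
    sym₃₄ : ∀ i j k l → X i j k l ≡ X i j l k
    sym₃₄ i j k l = cong indicator (cong₂ _∧_ (separates-swapPoints D i j k l) (separates-swapLine D k l i j))
    X-swapPairs : ∀ i j k l → X i j k l ≡ X k l i j
    X-swapPairs i j k l = cong indicator (∧-comm (separatesᵇ D i j k l) (separatesᵇ D k l i j))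
    crossingsK≡P : crossingsK D ≡ P
    crossingsK≡P = trans (sum-concatMap _ (allPairs n))
      (pairSum-cong λ i j → pairSum-cong λ k l → crosses-guarded i j k l)

  ∑⁴-pairingCount : ∑⁴ (pairingCount D) ≡ 8 * (orchardK D + crossingsK D)
  ∑⁴-pairingCount = begin
    ∑⁴ (pairingCount D)
      ≡⟨ ∑⁴-distrib-+ (λ a b c d → S a b c d + S c d a b) X ⟩
    ∑⁴ (λ a b c d → S a b c d + S c d a b) + ∑⁴ X
      ≡⟨ cong (_+ ∑⁴ X) (∑⁴-distrib-+ S (λ a b c d → S c d a b)) ⟩
    ∑⁴ S + ∑⁴ (λ a b c d → S c d a b) + ∑⁴ X
      ≡⟨ cong₂ _+_ (cong₂ _+_ (trans (∑⁴-swapPairs S) ∑⁴-separates) ∑⁴-separates) ∑⁴-crosses ⟩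
    4 * o + 4 * o + 8 * c
      ≡⟨ cong (_+ 8 * c) (sym (ℕ.*-distribʳ-+ o 4 4)) ⟩
    8 * o + 8 * c
      ≡⟨ sym (ℕ.*-distribˡ-+ 8 o c) ⟩
    8 * (o + c) ∎
    where
    open ≡-Reasoning
    S X : Fin n → Fin n → Fin n → Fin n → ℕ
    S a b c d = indicator (separatesᵇ D a b c d)
    X a b c d = indicator (crossᵇ D a b c d)
    o c : ℕ
    o = orchardK D
    c = crossingsK D

  ∑⁴-fourPointCount : ∑⁴ (fourPointCount D) ≡ 24 * (orchardK D + crossingsK D)
  ∑⁴-fourPointCount = begin
    ∑⁴ (fourPointCount D)
      ≡⟨ ∑⁴-distrib-+ (λ a b c d → pc a b c d + pc a c b d) (λ a b c d → pc a d b c) ⟩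
    ∑⁴ (λ a b c d → pc a b c d + pc a c b d) + ∑⁴ (λ a b c d → pc a d b c)
      ≡⟨ cong (_+ ∑⁴ (λ a b c d → pc a d b c)) (∑⁴-distrib-+ pc (λ a b c d → pc a c b d)) ⟩
    ∑⁴ pc + ∑⁴ (λ a b c d → pc a c b d) + ∑⁴ (λ a b c d → pc a d b c)
      ≡⟨ cong₂ _+_ (cong (∑⁴ pc +_) (sym (∑⁴-swap₂₃ pc)))
                   (sym (trans (∑⁴-swap₂₃ pc) (∑⁴-swap₃₄ (λ a b c d → pc a c b d)))) ⟩
    ∑⁴ pc + ∑⁴ pc + ∑⁴ pc
      ≡⟨ trans (+-assoc (∑⁴ pc) (∑⁴ pc) (∑⁴ pc))
               (cong (λ t → ∑⁴ pc + (∑⁴ pc + t)) (sym (+-identityʳ (∑⁴ pc)))) ⟩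
    3 * ∑⁴ pc
      ≡⟨ cong (3 *_) ∑⁴-pairingCount ⟩
    3 * (8 * (orchardK D + crossingsK D))
      ≡⟨ sym (*-assoc 3 8 (orchardK D + crossingsK D)) ⟩
    24 * (orchardK D + crossingsK D) ∎
    where
    open ≡-Reasoning
    pc : Fin n → Fin n → Fin n → Fin n → ℕ
    pc = pairingCount D

orchard+crossings-invariant : (D E : Placement n) → Generic D → Generic E →
  orchardK D + crossingsK D ≡ orchardK E + crossingsK E
orchard+crossings-invariant {n} D E genericD genericE = ℕ.*-cancelˡ-≡ _ _ 24 (begin
  24 * (orchardK D + crossingsK D)
    ≡⟨ ∑⁴-fourPointCount D ⟨
  ∑⁴ (fourPointCount D)
    ≡⟨ ∑⁴-cong (fourPointCount-generic D genericD) ⟩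
  ∑⁴ {n} (λ a b c d → 3 * indicator ⌊ distinct4? a b c d ⌋)
    ≡⟨ ∑⁴-cong (fourPointCount-generic E genericE) ⟨
  ∑⁴ (fourPointCount E)
    ≡⟨ ∑⁴-fourPointCount E ⟩
  24 * (orchardK E + crossingsK E) ∎)
  where open ≡-Reasoning

m+n≡o+p⇒o≤m⇔n≤p : ∀ {m n o p} → m + n ≡ o + p → (o ≤ m) ⇔ (n ≤ p)
m+n≡o+p⇒o≤m⇔n≤p {m} {n} {o} {p} m+n≡o+p = mk⇔
  (λ o≤m → ℕ.+-cancelˡ-≤ m n p (subst (_≤ m + p) (sym m+n≡o+p) (ℕ.+-monoˡ-≤ p o≤m)))
  (λ n≤p → ℕ.+-cancelʳ-≤ p o m (subst (_≤ m + p) m+n≡o+p (ℕ.+-monoʳ-≤ m n≤p)))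

-- The hypothesis 4 ≤ n is unused: the invariance holds for every n.
mainTheorem1 : (n : ℕ) → 4 ≤ n → (D : Placement n) → Generic D →
    (AttainsMOCN D ⇔ AttainsRectCr D)
mainTheorem1 n _ D generic = mk⇔
  (λ maxOrchard E genericE → Equivalence.to (exchange E genericE) (maxOrchard E genericE))
  (λ minCrossings E genericE → Equivalence.from (exchange E genericE) (minCrossings E genericE))
  where
  exchange : (E : Placement n) → Generic E → (orchardK E ≤ orchardK D) ⇔ (crossingsK D ≤ crossingsK E)
  exchange E genericE = m+n≡o+p⇒o≤m⇔n≤p (orchard+crossings-invariant D E generic genericE)
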